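{- Let $P_m$ denote the path on $m$ vertices. If $t\ge 4k\ge 8$ are integers, then $\chi_{\mu_i}(P_t\boxtimes P_{4k})=\frac{\operatorname{diag}(P_t\boxtimes P_{4k})}{2}=2k$. Moreover, $\chi_{\mu_i}(P_t\boxtimes P_r)=4$ for all integers $t\ge r$ with $r\in\{3,4,5,6,7\}$.
   Context: All graphs are finite and simple. The strong product $G\boxtimes H$ has vertex set $V(G)\times V(H)$, with distinct $(g,h),(g',h')$ adjacent iff ($g=g'$ or $gg'\in E(G)$) and ($h=h'$ or $hh'\in E(H)$). A subgraph is convex if every geodesic (shortest path) between two of its vertices lies entirely in it; a convex path is a path subgraph that is convex. If $g_1\dots g_k$ and $h_1\dots h_k$ are convex paths in $G$ and $H$, the subgraph of $G\boxtimes H$ induced by $\{(g_1,h_1),\dots,(g_k,h_k)\}$ is a diagonal; $\operatorname{diag}(G\boxtimes H)$ is the maximum number of vertices of a diagonal. For $X\subseteq V$, two vertices $x,y\in X$ are $X$-visible if some $x,y$-geodesic has no internal vertex in $X$; $X$ is an independent mutual-visibility (IMV) set if $X$ is independent and every two of its vertices are $X$-visible. $\chi_{\mu_i}$ is the least $k$ such that the vertex set can be partitioned into $k$ IMV sets. -}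

module Defs where

open import Data.Nat using (ℕ; zero; suc; _+_; _≤_; _<_)
open import Data.Fin using (Fin; toℕ)
open import Data.Product using (Σ; _×_; _,_)
open import Data.Sum using (_⊎_)
open import Data.Unit using (⊤)
open import Relation.Nullary using (¬_)
open import Relation.Binary.PropositionalEquality using (_≡_; _≢_)
open import Function.Definitions using (Injective)

record Graph : Set₁ where
  field
    V   : Set
    Adj : V → V → Set
open Graph public

P : ℕ → Graph
P m = record { V = Fin m ; Adj = λ i j → (suc (toℕ i) ≡ toℕ j) ⊎ (suc (toℕ j) ≡ toℕ i) }

AdjOrEq : (G : Graph) → V G → V G → Set
AdjOrEq G x y = (x ≡ y) ⊎ Adj G x y

_⊠_ : Graph → Graph → Graph
G ⊠ H = record
  { V = V G × V H
  ; Adj = λ { (g , h) (g' , h') →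
      ((g , h) ≢ (g' , h')) × AdjOrEq G g g' × AdjOrEq H h h' } }

data Walk (G : Graph) : V G → V G → Set where
  [_]    : (x : V G) → Walk G x x
  _∷⟨_⟩_ : (x : V G) {y z : V G} → Adj G x y → Walk G y z → Walk G x z

len : {G : Graph} {x y : V G} → Walk G x y → ℕ
len [ x ] = 0
len (x ∷⟨ _ ⟩ w) = suc (len w)

-- A geodesic: a walk x → y of minimum length among all x,y-walks
-- (such a walk is automatically a path, i.e. a shortest path).
Geodesic : (G : Graph) {x y : V G} → Walk G x y → Set
Geodesic G {x} {y} w = (w' : Walk G x y) → len w ≤ len w'

AllVerts : {G : Graph} (Q : V G → Set) {x y : V G} → Walk G x y → Set
AllVerts Q [ x ] = Q x
AllVerts Q (x ∷⟨ _ ⟩ w) = Q x × AllVerts Q w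

AllButLast : {G : Graph} (Q : V G → Set) {x y : V G} → Walk G x y → Set
AllButLast Q [ x ] = ⊤
AllButLast Q (x ∷⟨ _ ⟩ w) = Q x × AllButLast Q w

AllInternal : {G : Graph} (Q : V G → Set) {x y : V G} → Walk G x y → Set
AllInternal Q [ x ] = ⊤
AllInternal Q (x ∷⟨ _ ⟩ w) = AllButLast Q w

AllEdges : {G : Graph} (R : V G → V G → Set) {x y : V G} → Walk G x y → Set
AllEdges R [ x ] = ⊤
AllEdges R (_∷⟨_⟩_ x {y} _ w) = R x y × AllEdges R w

Independent : (G : Graph) → (V G → Set) → Set
Independent G X = ∀ x y → X x → X y → ¬ Adj G x y

Visible : (G : Graph) → (V G → Set) → V G → V G → Set
Visible G X x y = Σ (Walk G x y) λ w → Geodesic G w × AllInternal (λ v → ¬ X v) w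

IsIMV : (G : Graph) → (V G → Set) → Set
IsIMV G X = Independent G X × (∀ x y → X x → X y → x ≢ y → Visible G X x y)

HasIMVPartition : Graph → ℕ → Set
HasIMVPartition G k = Σ (V G → Fin k) λ c → (i : Fin k) → IsIMV G (λ v → c v ≡ i)

IsChiMuI : Graph → ℕ → Set
IsChiMuI G k = HasIMVPartition G k × (∀ m → m < k → ¬ HasIMVPartition G m)

-- p : Fin k → V G lists the vertices g₁ … g_k of a path subgraph
PathEdge : (G : Graph) {k : ℕ} → (Fin k → V G) → V G → V G → Set
PathEdge G {k} p u v = Σ (Fin k) λ i → Σ (Fin k) λ j →
  ((suc (toℕ i) ≡ toℕ j) ⊎ (suc (toℕ j) ≡ toℕ i)) × (p i ≡ u) × (p j ≡ v)

InPath : (G : Graph) {k : ℕ} → (Fin k → V G) → V G → Set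
InPath G {k} p v = Σ (Fin k) λ i → p i ≡ v

ConvexPath : (G : Graph) (k : ℕ) → (Fin k → V G) → Set
ConvexPath G k p =
  Injective _≡_ _≡_ p ×
  (∀ i j → suc (toℕ i) ≡ toℕ j → Adj G (p i) (p j)) ×
  (∀ i j (w : Walk G (p i) (p j)) → Geodesic G w →
      AllVerts (InPath G p) w × AllEdges (PathEdge G p) w)

-- G ⊠ H has a diagonal on k vertices {(g₁,h₁),…,(g_k,h_k)}
HasDiagonal : Graph → Graph → ℕ → Set
HasDiagonal G H k = Σ (Fin k → V G) λ p → Σ (Fin k → V H) λ q →
  ConvexPath G k p × ConvexPath H k q

IsDiag : Graph → Graph → ℕ → Set
IsDiag G H d = HasDiagonal G H d × (∀ k → HasDiagonal G H k → k ≤ d)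

{-# OPTIONS --safe #-}
module Submission where

-- For i < j < l every geodesic between the diagonal vertices (i , i) and
-- (l , l) passes through (j , j), so an independent mutual-visibility set contains at most two
-- of the 4k vertices of a diagonal, and at least 2k sets are needed.  For r ≥ 2 the 2 × 2
-- corner is a 4-clique, so at least 4 are needed.
--
-- The rows of one parity form a slice, and the 2k rows of a slice are grouped into
-- k blocks of two consecutive rows.  A colour class lies in one slice, on the four rows of two
-- blocks, and on each of these rows it uses only one column parity; from bottom to top these
-- parities read a, ā, ā, a.  Such a class is independent.  Two of its vertices u, v, with u on
-- an outer row or both on inner rows, see each other along a king's geodesic each of whose
-- inner vertices lies either in the other slice or strictly between the rows of u and v in a
-- column of the parity of u; the class has no vertex there.

open import Defs
open import Data.Bool using (if_then_else_)
open import Data.Empty using (⊥; ⊥-elim)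
open import Data.Fin as Fin using (Fin; toℕ; fromℕ<)
open import Data.Fin.Patterns using (0F; 1F; 2F; 3F)
open import Data.Fin.Properties
  using (toℕ-injective; toℕ<n; toℕ-fromℕ<; toℕ-inject≤; inject≤-injective; injective⇒≤; remQuot-combine;
         toℕ-↑ˡ; toℕ-↑ʳ; ↑ˡ-injective; ↑ʳ-injective; any?; pigeonhole)
  renaming (_≟_ to _≟F_; _<?_ to _<?F_)
open import Data.Nat using (ℕ; zero; suc; pred; _+_; _*_; _∸_; _≤_; _<_; _⊓_; _⊔_; ∣_-_∣;
                            z≤n; s≤s; s≤s⁻¹; z<s; s<s; _≤?_; _<?_; >-nonZero; parity)
open import Data.Nat.DivMod using (_/_; _%_; _mod_; _divMod_; DivMod; m<n*o⇒m/o<n; m%n<n; m≡m%n+[m/n]*n)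
open import Data.Nat.Properties
open import Data.Parity.Base using (Parity; 0ℙ; 1ℙ) renaming (_+_ to _⊕_; _*_ to _⊗_)
open import Data.Parity.Properties using (+-homo-+; *-homo-*; p+p≡0ℙ; p≢p⁻¹)
  renaming (_≟_ to _≟ℙ_; +-assoc to ⊕-assoc; +-comm to ⊕-comm; +-identityʳ to ⊕-identityʳ;
            +-cancelˡ-≡ to ⊕-cancelˡ-≡; *-zeroʳ to ⊗-zeroʳ)
open import Data.Product using (Σ; ∃; _×_; _,_; proj₁; proj₂)
open import Data.Sum using (_⊎_; inj₁; inj₂; swap)
open import Data.Unit using (tt)
open import Function using (_∘_)
open import Relation.Binary.Definitions using (Symmetric; Tri; tri<; tri≈; tri>)
open import Relation.Binary.PropositionalEquality
open import Relation.Nullary using (¬_; Dec; yes; no; does)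
open import Relation.Nullary.Decidable using (dec-true; dec-false; _×-dec_)

-- Distances and parities of natural numbers

Near : ℕ → ℕ → Set
Near a b = ∣ a - b ∣ ≤ 1

near-refl : ∀ a → Near a a
near-refl a = subst (_≤ 1) (sym (∣n-n∣≡0 a)) z≤n

near-sym : ∀ {a b} → Near a b → Near b a
near-sym {a} {b} = subst (_≤ 1) (∣-∣-comm a b)

near-suc : ∀ a → Near a (suc a)
near-suc zero    = ≤-refl
near-suc (suc a) = near-suc a

near-cases : ∀ {a b} → Near a b → a ≡ b ⊎ suc a ≡ b ⊎ suc b ≡ a
near-cases {zero}        {zero}        _ = inj₁ refl
near-cases {zero}        {suc zero}    _ = inj₂ (inj₁ refl)
near-cases {suc zero}    {zero}        _ = inj₂ (inj₂ refl)
near-cases {zero}        {suc (suc b)} (s≤s ())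
near-cases {suc (suc a)} {zero}        (s≤s ())
near-cases {suc a}       {suc b}       d with near-cases {a} {b} d
... | inj₁ e        = inj₁ (cong suc e)
... | inj₂ (inj₁ e) = inj₂ (inj₁ (cong suc e))
... | inj₂ (inj₂ e) = inj₂ (inj₂ (cong suc e))

parity-suc : ∀ n → parity (suc n) ≡ 1ℙ ⊕ parity n
parity-suc n = +-homo-+ 1 n

parity-∣-∣ : ∀ a b → parity b ≡ parity a ⊕ parity ∣ a - b ∣
parity-∣-∣ zero    b       = refl
parity-∣-∣ (suc a) zero    = sym (p+p≡0ℙ (parity (suc a)))
parity-∣-∣ (suc a) (suc b) = begin
  parity (suc b)                       ≡⟨ parity-suc b ⟩
  1ℙ ⊕ parity b                        ≡⟨ cong (1ℙ ⊕_) (parity-∣-∣ a b) ⟩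
  1ℙ ⊕ (parity a ⊕ parity ∣ a - b ∣)   ≡⟨ sym (⊕-assoc 1ℙ (parity a) _) ⟩
  (1ℙ ⊕ parity a) ⊕ parity ∣ a - b ∣   ≡⟨ cong (_⊕ parity ∣ a - b ∣) (sym (parity-suc a)) ⟩
  parity (suc a) ⊕ parity ∣ a - b ∣    ∎
  where open ≡-Reasoning

near∧parity≡⇒≡ : ∀ {a b} → Near a b → parity a ≡ parity b → a ≡ b
near∧parity≡⇒≡ {a} {b} d pa≡pb with near-cases d
... | inj₁ a≡b        = a≡b
... | inj₂ (inj₁ refl) = ⊥-elim (p≢p⁻¹ (parity a) (trans pa≡pb (parity-suc a)))
... | inj₂ (inj₂ refl) = ⊥-elim (p≢p⁻¹ (parity b) (trans (sym pa≡pb) (parity-suc b)))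

even-offset : ∀ a b {p} → parity b ≡ parity a ⊕ p → parity b ≡ parity a → p ≡ 0ℙ
even-offset a b {p} b≡a+p b≡a = ⊕-cancelˡ-≡ (parity a) p 0ℙ
  (trans (sym b≡a+p) (trans b≡a (sym (⊕-identityʳ (parity a)))))

odd-offset : ∀ a b {p} → p ≡ 1ℙ → parity b ≡ parity a ⊕ p → parity b ≢ parity a
odd-offset a b refl b≡a+1 b≡a with () ← even-offset a b b≡a+1 b≡a

odd⇒positive : ∀ {n} → parity n ≡ 1ℙ → 0 < n
odd⇒positive {suc n} _ = z<s

parity-⊓ : ∀ {i E} → parity i ≡ 0ℙ → parity E ≡ 0ℙ → parity (i ⊓ E) ≡ 0ℙ
parity-⊓ {i} {E} pi pE with ⊓-sel i E
... | inj₁ i⊓E≡i = trans (cong parity i⊓E≡i) pi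
... | inj₂ i⊓E≡E = trans (cong parity i⊓E≡E) pE

evenFloor : ∀ n → Σ ℕ λ E → parity E ≡ 0ℙ × E ≤ n × n ≤ suc E
evenFloor zero          = 0 , refl , z≤n , z≤n
evenFloor (suc zero)    = 0 , refl , z≤n , ≤-refl
evenFloor (suc (suc n)) with evenFloor n
... | E , pE , E≤n , n≤1+E = suc (suc E) , pE , s≤s (s≤s E≤n) , s≤s (s≤s n≤1+E)

parity-+-*2 : ∀ a j → parity (a + j * 2) ≡ parity a
parity-+-*2 a j = begin
  parity (a + j * 2)              ≡⟨ +-homo-+ a (j * 2) ⟩
  parity a ⊕ parity (j * 2)       ≡⟨ cong (parity a ⊕_) (*-homo-* j 2) ⟩
  parity a ⊕ (parity j ⊗ 0ℙ)      ≡⟨ cong (parity a ⊕_) (⊗-zeroʳ (parity j)) ⟩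
  parity a ⊕ 0ℙ                   ≡⟨ ⊕-identityʳ (parity a) ⟩
  parity a                        ∎
  where open ≡-Reasoning

≢⇒≡1ℙ⊕ : ∀ {p q} → p ≢ q → p ≡ 1ℙ ⊕ q
≢⇒≡1ℙ⊕ {0ℙ} {0ℙ} p≢q = ⊥-elim (p≢q refl)
≢⇒≡1ℙ⊕ {0ℙ} {1ℙ} _   = refl
≢⇒≡1ℙ⊕ {1ℙ} {0ℙ} _   = refl
≢⇒≡1ℙ⊕ {1ℙ} {1ℙ} p≢q = ⊥-elim (p≢q refl)

Between : ℕ → ℕ → ℕ → Set
Between a y b = (a < y × y < b) ⊎ (b < y × y < a)

¬between-near : ∀ {a y b} → Near a b → ¬ Between a y b
¬between-near {a} {y} {b} d btw with near-cases {a} {b} d | btw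
... | inj₁ refl        | inj₁ (a<y , y<a) = <-asym a<y y<a
... | inj₁ refl        | inj₂ (a<y , y<a) = <-asym a<y y<a
... | inj₂ (inj₁ refl) | inj₁ (a<y , y<b) = <⇒≱ a<y (s≤s⁻¹ y<b)
... | inj₂ (inj₁ refl) | inj₂ (b<y , y<a) = <-asym (<-trans (n<1+n _) b<y) y<a
... | inj₂ (inj₂ refl) | inj₁ (a<y , y<b) = <-asym (<-trans (n<1+n _) a<y) y<b
... | inj₂ (inj₂ refl) | inj₂ (b<y , y<a) = <⇒≱ b<y (s≤s⁻¹ y<a)

between-trans : ∀ {a y b c} → Between a y b → Between a b c → Between a y c
between-trans (inj₁ (a<y , y<b)) (inj₁ (_ , b<c))   = inj₁ (a<y , <-trans y<b b<c)
between-trans (inj₂ (b<y , y<a)) (inj₂ (c<b , _))   = inj₂ (<-trans c<b b<y , y<a)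
between-trans (inj₁ (a<y , y<b)) (inj₂ (_ , b<a))   = ⊥-elim (<-asym (<-trans a<y y<b) b<a)
between-trans (inj₂ (b<y , y<a)) (inj₁ (a<b , _))   = ⊥-elim (<-asym (<-trans b<y y<a) a<b)

detour⇒≤⊔ : ∀ {a z b} → ∣ a - z ∣ + ∣ z - b ∣ ≤ ∣ a - b ∣ → z ≤ a ⊔ b
detour⇒≤⊔ {a} {z} {b} h with ≤-total a b
... | inj₁ a≤b = ≤-trans (≮⇒≥ λ b<z → <⇒≱ (far b<z) (≤-trans (m≤m+n _ _) h)) (m≤n⊔m a b)
  where
  far : b < z → ∣ a - b ∣ < ∣ a - z ∣
  far b<z rewrite m≤n⇒∣m-n∣≡n∸m a≤b | m≤n⇒∣m-n∣≡n∸m (≤-trans a≤b (<⇒≤ b<z)) = ∸-monoˡ-< b<z a≤b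
... | inj₂ b≤a = ≤-trans (≮⇒≥ λ a<z → <⇒≱ (far a<z) (≤-trans (m≤n+m _ _) h)) (m≤m⊔n a b)
  where
  far : a < z → ∣ a - b ∣ < ∣ z - b ∣
  far a<z rewrite ∣-∣-comm a b | ∣-∣-comm z b
                | m≤n⇒∣m-n∣≡n∸m b≤a | m≤n⇒∣m-n∣≡n∸m (≤-trans b≤a (<⇒≤ a<z)) = ∸-monoˡ-< a<z b≤a

toward : ℕ → ℕ → ℕ → ℕ
toward zero    b       i = i ⊓ b
toward (suc a) zero    i = suc a ∸ i
toward (suc a) (suc b) i = suc (toward a b i)

toward-0 : ∀ a b → toward a b 0 ≡ a
toward-0 zero    b       = refl
toward-0 (suc a) zero    = refl
toward-0 (suc a) (suc b) = cong suc (toward-0 a b)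

toward-end : ∀ a b {i} → ∣ a - b ∣ ≤ i → toward a b i ≡ b
toward-end zero    b       d≤i = m≥n⇒m⊓n≡n d≤i
toward-end (suc a) zero    d≤i = m≤n⇒m∸n≡0 d≤i
toward-end (suc a) (suc b) d≤i = cong suc (toward-end a b d≤i)

toward-dist : ∀ a b {i} → i ≤ ∣ a - b ∣ → ∣ a - toward a b i ∣ ≡ i
toward-dist zero    b       i≤d = m≤n⇒m⊓n≡m i≤d
toward-dist (suc a) zero    {i} i≤d = begin
  ∣ suc a - suc a ∸ i ∣   ≡⟨ ∣-∣-comm (suc a) (suc a ∸ i) ⟩
  ∣ suc a ∸ i - suc a ∣   ≡⟨ m≤n⇒∣m-n∣≡n∸m (m∸n≤m (suc a) i) ⟩
  suc a ∸ (suc a ∸ i)     ≡⟨ m∸[m∸n]≡n i≤d ⟩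
  i                       ∎
  where open ≡-Reasoning
toward-dist (suc a) (suc b) i≤d = toward-dist a b i≤d

near-⊓ : ∀ i b → Near (i ⊓ b) (suc i ⊓ b)
near-⊓ zero    zero    = z≤n
near-⊓ (suc i) zero    = z≤n
near-⊓ zero    (suc b) = near-suc 0
near-⊓ (suc i) (suc b) = near-⊓ i b

near-∸ : ∀ a i → Near (a ∸ i) (a ∸ suc i)
near-∸ zero    zero    = z≤n
near-∸ zero    (suc i) = z≤n
near-∸ (suc a) zero    = near-sym {a} (near-suc a)
near-∸ (suc a) (suc i) = near-∸ a i

toward-near : ∀ a b i → Near (toward a b i) (toward a b (suc i))
toward-near zero    b       i = near-⊓ i b
toward-near (suc a) zero    i = near-∸ (suc a) i
toward-near (suc a) (suc b) i = toward-near a b i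

toward-moves : ∀ a b {i} → i < ∣ a - b ∣ → toward a b i ≢ toward a b (suc i)
toward-moves a b {i} i<d eq = 1+n≢n (begin
  suc i                         ≡⟨ sym (toward-dist a b i<d) ⟩
  ∣ a - toward a b (suc i) ∣    ≡⟨ cong ∣ a -_∣ (sym eq) ⟩
  ∣ a - toward a b i ∣          ≡⟨ toward-dist a b (<⇒≤ i<d) ⟩
  i                             ∎)
  where open ≡-Reasoning

toward-≤ : ∀ a b i → toward a b i ≤ a ⊔ b
toward-≤ zero    b       i = m⊓n≤n i b
toward-≤ (suc a) zero    i = m∸n≤m (suc a) i
toward-≤ (suc a) (suc b) i = s≤s (toward-≤ a b i)

toward-between : ∀ a b {i} → 0 < i → i < ∣ a - b ∣ → Between a (toward a b i) b
toward-between zero    b       {i} 0<i i<d rewrite m≤n⇒m⊓n≡m (<⇒≤ i<d) = inj₁ (0<i , i<d)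
toward-between (suc a) zero    0<i i<d = inj₂ (m<n⇒0<n∸m i<d , ∸-monoʳ-< 0<i (<⇒≤ i<d))
toward-between (suc a) (suc b) 0<i i<d with toward-between a b 0<i i<d
... | inj₁ (l , r) = inj₁ (s<s l , s<s r)
... | inj₂ (l , r) = inj₂ (s<s l , s<s r)

toward-parity : ∀ a b {i} → i ≤ ∣ a - b ∣ → parity (toward a b i) ≡ parity a ⊕ parity i
toward-parity a b {i} i≤d =
  trans (parity-∣-∣ a _) (cong (λ d → parity a ⊕ parity d) (toward-dist a b i≤d))

toward-even-parity : ∀ a b {i} → i ≤ ∣ a - b ∣ → parity i ≡ 0ℙ → parity (toward a b i) ≡ parity a
toward-even-parity a b {i} i≤d i-even =
  trans (toward-parity a b i≤d) (trans (cong (parity a ⊕_) i-even) (⊕-identityʳ (parity a)))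

toward-near-⊓ : ∀ a b i E → Near (toward a b (i ⊓ E)) (toward a b (suc i ⊓ E))
toward-near-⊓ a b i E with i <? E
... | yes i<E rewrite m≤n⇒m⊓n≡m (<⇒≤ i<E) | m≤n⇒m⊓n≡m i<E = toward-near a b i
... | no  i≮E rewrite m≥n⇒m⊓n≡n (≮⇒≥ i≮E) | m≥n⇒m⊓n≡n (m≤n⇒m≤1+n (≮⇒≥ i≮E)) =
  near-refl (toward a b E)

-- Walks and routes

record Lipschitz (G : Graph) (f : V G → ℕ) : Set where
  constructor lipschitz
  field near-step : ∀ {u v} → Adj G u v → Near (f u) (f v)

open Lipschitz

module _ {G : Graph} where

  allVerts-map : ∀ {P Q : V G → Set} → (∀ {z} → P z → Q z) →
                 ∀ {u v} (w : Walk G u v) → AllVerts P w → AllVerts Q w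
  allVerts-map P⇒Q [ _ ]         p        = P⇒Q p
  allVerts-map P⇒Q (_ ∷⟨ _ ⟩ w) (p , ps) = P⇒Q p , allVerts-map P⇒Q w ps

  allVerts-head : ∀ {Q : V G → Set} {u v} (w : Walk G u v) → AllVerts Q w → Q u
  allVerts-head [ _ ]         q       = q
  allVerts-head (_ ∷⟨ _ ⟩ _) (q , _) = q

  allVerts⇒allEdges : ∀ {Q : V G → Set} {E : V G → V G → Set} →
                      (∀ {a b} → Adj G a b → Q a → Q b → E a b) →
                      ∀ {u v} (w : Walk G u v) → AllVerts Q w → AllEdges E w
  allVerts⇒allEdges edge [ _ ]         _        = tt
  allVerts⇒allEdges edge (_ ∷⟨ a ⟩ w) (q , qs) = edge a q (allVerts-head w qs) , allVerts⇒allEdges edge w qs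

  allButLast⇒allInternal : ∀ {Q : V G → Set} {u v} (w : Walk G u v) → AllButLast Q w → AllInternal Q w
  allButLast⇒allInternal [ _ ]         _        = tt
  allButLast⇒allInternal (_ ∷⟨ _ ⟩ _) (_ , qs) = qs

module _ {G : Graph} {f : V G → ℕ} (f-lipschitz : Lipschitz G f) where

  ∣-∣≤len : {u v : V G} (w : Walk G u v) → ∣ f u - f v ∣ ≤ len w
  ∣-∣≤len [ u ] = ≤-reflexive (∣n-n∣≡0 (f u))
  ∣-∣≤len (u ∷⟨ e ⟩ w) =
    ≤-trans (∣-∣-triangle (f u) _ _) (+-mono-≤ (near-step f-lipschitz e) (∣-∣≤len w))

  tight-first-step : ∀ {u u′ v d} → Adj G u u′ → (w : Walk G u′ v) →
               f v ≡ f u + suc d → len w ≤ d → f u′ ≡ suc (f u)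
  tight-first-step {u} {u′} {v} {d} u~u′ w fv≡ len≤d = ≤-antisym at-most at-least
    where
    at-most : f u′ ≤ suc (f u)
    at-most = ≤-trans (m≤n+∣n-m∣ (f u′) (f u))
                      (≤-trans (+-monoʳ-≤ (f u) (near-step f-lipschitz u~u′)) (≤-reflexive (+-comm (f u) 1)))
    at-least : suc (f u) ≤ f u′
    at-least = +-cancelʳ-≤ d (suc (f u)) (f u′) (begin
      suc (f u) + d          ≡⟨ sym (+-suc (f u) d) ⟩
      f u + suc d            ≡⟨ sym fv≡ ⟩
      f v                    ≤⟨ m≤n+∣n-m∣ (f v) (f u′) ⟩
      f u′ + ∣ f u′ - f v ∣  ≤⟨ +-monoʳ-≤ (f u′) (≤-trans (∣-∣≤len w) len≤d) ⟩
      f u′ + d               ∎)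
      where open ≤-Reasoning

  detour≤len : ∀ {u v} (w : Walk G u v) → AllVerts (λ z → ∣ f u - f z ∣ + ∣ f z - f v ∣ ≤ len w) w
  detour≤len {u} [ _ ] rewrite ∣n-n∣≡0 (f u) = z≤n
  detour≤len {u} {v} (_∷⟨_⟩_ _ {u′} u~u′ w) =
    subst (_≤ suc (len w)) (cong (_+ ∣ f u - f v ∣) (sym (∣n-n∣≡0 (f u))))
          (∣-∣≤len (u ∷⟨ u~u′ ⟩ w)) ,
    allVerts-map extend w (detour≤len w)
    where
    extend : ∀ {z} → ∣ f u′ - f z ∣ + ∣ f z - f v ∣ ≤ len w →
                     ∣ f u - f z ∣ + ∣ f z - f v ∣ ≤ suc (len w)
    extend {z} h = begin
      ∣ f u - f z ∣ + ∣ f z - f v ∣                    ≤⟨ +-monoˡ-≤ _ (∣-∣-triangle (f u) (f u′) (f z)) ⟩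
      ∣ f u - f u′ ∣ + ∣ f u′ - f z ∣ + ∣ f z - f v ∣  ≡⟨ +-assoc ∣ f u - f u′ ∣ _ _ ⟩
      ∣ f u - f u′ ∣ + (∣ f u′ - f z ∣ + ∣ f z - f v ∣) ≤⟨ +-mono-≤ (near-step f-lipschitz u~u′) h ⟩
      suc (len w)                                     ∎
      where open ≤-Reasoning

Steps : (G : Graph) → (ℕ → V G) → ℕ → Set
Steps G f n = ∀ {i} → i < n → Adj G (f i) (f (suc i))

record Route (G : Graph) (u v : V G) (n : ℕ) : Set where
  field
    at   : ℕ → V G
    at-0 : at 0 ≡ u
    at-n : at n ≡ v
    step : Steps G at n

open Route

Avoids : {G : Graph} {u v : V G} {n : ℕ} → Route G u v n → (V G → Set) → Set
Avoids {n = n} r X = ∀ {i} → 0 < i → i < n → ¬ X (at r i)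

n∸m≡1+n∸1+m : ∀ {m n} → m < n → n ∸ m ≡ suc (n ∸ suc m)
n∸m≡1+n∸1+m {n = suc n} (s≤s m≤n) = +-∸-assoc 1 m≤n

module _ {G : Graph} where

  walkAlong : (f : ℕ → V G) (n : ℕ) → Steps G f n → Walk G (f 0) (f n)
  walkAlong f zero    _    = [ f 0 ]
  walkAlong f (suc n) step = f 0 ∷⟨ step z<s ⟩ walkAlong (f ∘ suc) n (step ∘ s<s)

  len-walkAlong : ∀ f n (step : Steps G f n) → len (walkAlong f n step) ≡ n
  len-walkAlong f zero    _    = refl
  len-walkAlong f (suc n) step = cong suc (len-walkAlong (f ∘ suc) n (step ∘ s<s))

  allButLast-walkAlong : ∀ (Q : V G → Set) f n (step : Steps G f n) →
    (∀ {i} → i < n → Q (f i)) → AllButLast Q (walkAlong f n step)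
  allButLast-walkAlong Q f zero    _    _ = tt
  allButLast-walkAlong Q f (suc n) step q =
    q z<s , allButLast-walkAlong Q (f ∘ suc) n (step ∘ s<s) (q ∘ s<s)

  allInternal-walkAlong : ∀ (Q : V G → Set) f n (step : Steps G f n) →
    (∀ {i} → 0 < i → i < n → Q (f i)) → AllInternal Q (walkAlong f n step)
  allInternal-walkAlong Q f zero    _    _ = tt
  allInternal-walkAlong Q f (suc n) step q =
    allButLast-walkAlong Q (f ∘ suc) n (step ∘ s<s) (q z<s ∘ s<s)

  route-walk : ∀ {u v n} (r : Route G u v n) →
    Σ (Walk G u v) λ w →
      len w ≡ n × (∀ (Q : V G → Set) → (∀ {i} → 0 < i → i < n → Q (at r i)) → AllInternal Q w)
  route-walk {n = n} record { at = f ; at-0 = refl ; at-n = refl ; step = step } =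
    walkAlong f n step , len-walkAlong f n step , λ Q → allInternal-walkAlong Q f n step

  route-visible : ∀ {X u v n} (r : Route G u v n) → (∀ (w : Walk G u v) → n ≤ len w) →
                  Avoids r X → Visible G X u v
  route-visible {X} r shortest clear with route-walk r
  ... | w , len-w , internal =
    w , (λ w′ → subst (_≤ len w′) (sym len-w) (shortest w′)) , internal (λ z → ¬ X z) clear

  reverse : Symmetric (Adj G) → ∀ {u v n} → Route G u v n → Route G v u n
  reverse sym-adj {n = n} r = record
    { at   = λ i → at r (n ∸ i)
    ; at-0 = at-n r
    ; at-n = trans (cong (at r) (n∸n≡0 n)) (at-0 r)
    ; step = λ {i} i<n → subst (λ j → Adj G (at r j) (at r (n ∸ suc i)))
                               (sym (n∸m≡1+n∸1+m i<n)) (sym-adj (step r (∸-monoʳ-< z<s i<n)))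
    }

  avoids-reverse : ∀ (sym-adj : Symmetric (Adj G)) {u v n X} (r : Route G u v n) →
                   Avoids r X → Avoids (reverse sym-adj r) X
  avoids-reverse _ r clear 0<i i<n = clear (m<n⇒0<n∸m i<n) (∸-monoʳ-< 0<i (<⇒≤ i<n))

  _▷_ : ∀ {u w v m} → Route G u w m → Adj G w v → Route G u v (suc m)
  _▷_ {w = w} {v} {m} r e = record
    { at   = extended
    ; at-0 = trans (extended-≤ z≤n) (at-0 r)
    ; at-n = extended-> ≤-refl
    ; step = extended-step
    }
    where
    extended : ℕ → V G
    extended i = if does (i ≤? m) then at r i else v
    extended-≤ : ∀ {i} → i ≤ m → extended i ≡ at r i
    extended-≤ {i} i≤m rewrite dec-true (i ≤? m) i≤m = refl
    extended-> : ∀ {i} → m < i → extended i ≡ v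
    extended-> {i} m<i rewrite dec-false (i ≤? m) (<⇒≱ m<i) = refl
    extended-step : Steps G extended (suc m)
    extended-step {i} (s≤s i≤m) with m≤n⇒m<n∨m≡n i≤m
    ... | inj₁ i<m = subst₂ (Adj G) (sym (extended-≤ i≤m)) (sym (extended-≤ i<m)) (step r i<m)
    ... | inj₂ refl = subst₂ (Adj G) (sym (trans (extended-≤ ≤-refl) (at-n r)))
                                     (sym (extended-> ≤-refl)) e

  avoids-▷ : ∀ {u w v m X} (r : Route G u w m) (e : Adj G w v) →
             (∀ {i} → 0 < i → i ≤ m → ¬ X (at r i)) → Avoids (r ▷ e) X
  avoids-▷ {m = m} {X} r e clear {i} 0<i (s≤s i≤m) x
    rewrite dec-true (i ≤? m) i≤m = clear 0<i i≤m x

-- Path graphs and the grid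

clamp : (M : ℕ) → ℕ → Fin (suc M)
clamp M x = fromℕ< (s≤s (m⊓n≤n x M))

toℕ-clamp : ∀ {M x} → x ≤ M → toℕ (clamp M x) ≡ x
toℕ-clamp {M} {x} x≤M = trans (toℕ-fromℕ< (s≤s (m⊓n≤n x M))) (m≤n⇒m⊓n≡m x≤M)

toℕ≤pred : ∀ {M} (i : Fin (suc M)) → toℕ i ≤ M
toℕ≤pred i = s≤s⁻¹ (toℕ<n i)

adjOrEq-sym : ∀ {G} → Symmetric (Adj G) → Symmetric (AdjOrEq G)
adjOrEq-sym _    (inj₁ e) = inj₁ (sym e)
adjOrEq-sym symG (inj₂ a) = inj₂ (symG a)

⊠-adj-sym : ∀ {G H} → Symmetric (Adj G) → Symmetric (Adj H) → Symmetric (Adj (G ⊠ H))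
⊠-adj-sym symG symH (u≢v , g~g′ , h~h′) =
  u≢v ∘ sym , adjOrEq-sym symG g~g′ , adjOrEq-sym symH h~h′

P-adj-sym : ∀ {m} → Symmetric (Adj (P m))
P-adj-sym = swap

adjOrEq⇒near : ∀ {m} {i j : Fin m} → AdjOrEq (P m) i j → Near (toℕ i) (toℕ j)
adjOrEq⇒near {i = i} (inj₁ refl)     = near-refl (toℕ i)
adjOrEq⇒near {i = i} (inj₂ (inj₁ e)) = subst (Near (toℕ i)) e (near-suc (toℕ i))
adjOrEq⇒near {j = j} (inj₂ (inj₂ e)) =
  subst (λ a → Near a (toℕ j)) e (near-sym {toℕ j} (near-suc (toℕ j)))

near⇒adjOrEq : ∀ {m} {i j : Fin m} → Near (toℕ i) (toℕ j) → AdjOrEq (P m) i j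
near⇒adjOrEq d with near-cases d
... | inj₁ e        = inj₁ (toℕ-injective e)
... | inj₂ (inj₁ e) = inj₂ (inj₁ e)
... | inj₂ (inj₂ e) = inj₂ (inj₂ e)

module _ {m : ℕ} where

  P-lipschitz : Lipschitz (P m) toℕ
  P-lipschitz = lipschitz λ a~b → adjOrEq⇒near (inj₂ a~b)

  near∧≢⇒adj : ∀ {a b : Fin m} → Near (toℕ a) (toℕ b) → toℕ a ≢ toℕ b → Adj (P m) a b
  near∧≢⇒adj d a≢b with near-cases d
  ... | inj₁ a≡b = ⊥-elim (a≢b a≡b)
  ... | inj₂ adj = adj

  straightRoute : (a b : Fin m) → Route (P m) a b ∣ toℕ a - toℕ b ∣
  straightRoute a b = record
    { at   = at′
    ; at-0 = toℕ-injective (trans (toℕ-at′ 0) (toward-0 (toℕ a) (toℕ b)))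
    ; at-n = toℕ-injective (trans (toℕ-at′ _) (toward-end (toℕ a) (toℕ b) ≤-refl))
    ; step = λ {s} s<d → near∧≢⇒adj
        (subst₂ Near (sym (toℕ-at′ s)) (sym (toℕ-at′ (suc s))) (toward-near (toℕ a) (toℕ b) s))
        (λ e → toward-moves (toℕ a) (toℕ b) s<d (trans (sym (toℕ-at′ s)) (trans e (toℕ-at′ (suc s)))))
    }
    where
    toward<m : ∀ s → toward (toℕ a) (toℕ b) s < m
    toward<m s = ≤-<-trans (toward-≤ (toℕ a) (toℕ b) s) (⊔-lub (toℕ<n a) (toℕ<n b))
    at′ : ℕ → Fin m
    at′ s = fromℕ< (toward<m s)
    toℕ-at′ : ∀ s → toℕ (at′ s) ≡ toward (toℕ a) (toℕ b) s
    toℕ-at′ s = toℕ-fromℕ< (toward<m s)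

  geodesic-len≤∣-∣ : ∀ {a b} (w : Walk (P m) a b) → Geodesic (P m) w → len w ≤ ∣ toℕ a - toℕ b ∣
  geodesic-len≤∣-∣ {a} {b} w geodesic with route-walk (straightRoute a b)
  ... | straight , len-straight , _ = subst (len w ≤_) len-straight (geodesic straight)

initialSegment-convex : ∀ {m N} (N≤m : N ≤ m) → ConvexPath (P m) N (λ j → Fin.inject≤ j N≤m)
initialSegment-convex {m} {N} N≤m = inject≤-injective N≤m N≤m _ _ , consecutive , convex
  where
  p : Fin N → Fin m
  p j = Fin.inject≤ j N≤m
  consecutive : ∀ i j → suc (toℕ i) ≡ toℕ j → Adj (P m) (p i) (p j)
  consecutive i j e = inj₁ (trans (cong suc (toℕ-inject≤ i N≤m)) (trans e (sym (toℕ-inject≤ j N≤m))))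
  convex : ∀ i j (w : Walk (P m) (p i) (p j)) → Geodesic (P m) w →
           AllVerts (InPath (P m) p) w × AllEdges (PathEdge (P m) p) w
  convex i j w geodesic = allVerts-map onSegment w within , allVerts⇒allEdges segmentEdge w within
    where
    p<N : ∀ k → toℕ (p k) < N
    p<N k = subst (_< N) (sym (toℕ-inject≤ k N≤m)) (toℕ<n k)
    within : AllVerts (λ z → toℕ z < N) w
    within = allVerts-map
      (λ h → ≤-<-trans (detour⇒≤⊔ (≤-trans h (geodesic-len≤∣-∣ w geodesic))) (⊔-lub (p<N i) (p<N j)))
      w (detour≤len P-lipschitz w)
    onSegment : ∀ {z} → toℕ z < N → InPath (P m) p z
    onSegment z<N = fromℕ< z<N , toℕ-injective (trans (toℕ-inject≤ _ N≤m) (toℕ-fromℕ< z<N))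
    segmentEdge : ∀ {a b} → Adj (P m) a b → toℕ a < N → toℕ b < N → PathEdge (P m) p a b
    segmentEdge a~b a<N b<N =
      fromℕ< a<N , fromℕ< b<N ,
      subst₂ (λ x y → (suc x ≡ y) ⊎ (suc y ≡ x)) (sym (toℕ-fromℕ< a<N)) (sym (toℕ-fromℕ< b<N)) a~b ,
      proj₂ (onSegment a<N) , proj₂ (onSegment b<N)

Grid : ℕ → ℕ → Graph
Grid T R = P (suc T) ⊠ P (suc R)

module _ {T R : ℕ} where

  x-coord y-coord : V (Grid T R) → ℕ
  x-coord = toℕ ∘ proj₁
  y-coord = toℕ ∘ proj₂

  point : ℕ → ℕ → V (Grid T R)
  point x y = clamp T x , clamp R y

  coords-injective : ∀ {u v} → x-coord u ≡ x-coord v → y-coord u ≡ y-coord v → u ≡ v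
  coords-injective ex ey = cong₂ _,_ (toℕ-injective ex) (toℕ-injective ey)

  point-coords : ∀ v → point (x-coord v) (y-coord v) ≡ v
  point-coords (a , b) = coords-injective (toℕ-clamp (toℕ≤pred a)) (toℕ-clamp (toℕ≤pred b))

  point-adj : ∀ {x x′ y y′} → x ≤ T → x′ ≤ T → y ≤ R → y′ ≤ R →
              Near x x′ → Near y y′ → x ≢ x′ ⊎ y ≢ y′ → Adj (Grid T R) (point x y) (point x′ y′)
  point-adj {x} {x′} {y} {y′} x≤T x′≤T y≤R y′≤R dx dy moved =
    distinct moved ,
    near⇒adjOrEq (subst₂ Near (sym (toℕ-clamp x≤T)) (sym (toℕ-clamp x′≤T)) dx) ,
    near⇒adjOrEq (subst₂ Near (sym (toℕ-clamp y≤R)) (sym (toℕ-clamp y′≤R)) dy)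
    where
    distinct : x ≢ x′ ⊎ y ≢ y′ → point x y ≢ point x′ y′
    distinct (inj₁ x≢x′) e =
      x≢x′ (trans (sym (toℕ-clamp x≤T)) (trans (cong x-coord e) (toℕ-clamp x′≤T)))
    distinct (inj₂ y≢y′) e =
      y≢y′ (trans (sym (toℕ-clamp y≤R)) (trans (cong y-coord e) (toℕ-clamp y′≤R)))

  grid-adj-sym : Symmetric (Adj (Grid T R))
  grid-adj-sym = ⊠-adj-sym P-adj-sym P-adj-sym

  x-lipschitz : Lipschitz (Grid T R) x-coord
  x-lipschitz = lipschitz λ (_ , a~a′ , _) → adjOrEq⇒near a~a′

  y-lipschitz : Lipschitz (Grid T R) y-coord
  y-lipschitz = lipschitz λ (_ , _ , b~b′) → adjOrEq⇒near b~b′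

  chebyshev : V (Grid T R) → V (Grid T R) → ℕ
  chebyshev u v = ∣ x-coord u - x-coord v ∣ ⊔ ∣ y-coord u - y-coord v ∣

  chebyshev-comm : ∀ u v → chebyshev u v ≡ chebyshev v u
  chebyshev-comm u v = cong₂ _⊔_ (∣-∣-comm (x-coord u) _) (∣-∣-comm (y-coord u) _)

  chebyshev≤len : ∀ {u v} (w : Walk (Grid T R) u v) → chebyshev u v ≤ len w
  chebyshev≤len w = ⊔-lub (∣-∣≤len x-lipschitz w) (∣-∣≤len y-lipschitz w)

-- Sightlines

module Sightlines {T R : ℕ} (X : V (Grid T R) → Set) where

  record Sightline (u v : V (Grid T R)) : Set where
    constructor sightline-of
    field
      {length} : ℕ
      short    : length ≤ chebyshev u v
      route    : Route (Grid T R) u v length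
      clear    : Avoids route X

  sightline⇒visible : ∀ {u v} → Sightline u v → Visible (Grid T R) X u v
  sightline⇒visible (sightline-of short r clear) =
    route-visible r (λ w → ≤-trans short (chebyshev≤len w)) clear

  sightline-reverse : ∀ {u v} → Sightline u v → Sightline v u
  sightline-reverse {u} {v} (sightline-of short r clear) =
    sightline-of (subst (_ ≤_) (chebyshev-comm u v) short) (reverse grid-adj-sym r)
                 (avoids-reverse grid-adj-sym {X = X} r clear)

  KingMove : ℕ → ℕ → ℕ → ℕ → Set
  KingMove x y x′ y′ = Near x x′ × Near y y′ × (x ≢ x′ ⊎ y ≢ y′)

  record LatticePath (u v : V (Grid T R)) (m : ℕ) : Set where
    field
      xs ys : ℕ → ℕ
      xs-0  : xs 0 ≡ x-coord u
      ys-0  : ys 0 ≡ y-coord u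
      xs≤T  : ∀ {i} → i ≤ m → xs i ≤ T
      ys≤R  : ∀ {i} → i ≤ m → ys i ≤ R
      moves : ∀ {i} → i < m → KingMove (xs i) (ys i) (xs (suc i)) (ys (suc i))
      lands : KingMove (xs m) (ys m) (x-coord v) (y-coord v)

  latticeSightline : ∀ {u v m} (p : LatticePath u v m) → suc m ≤ chebyshev u v →
    (let open LatticePath p in ∀ {i} → 0 < i → i ≤ m → ¬ X (point (xs i) (ys i))) → Sightline u v
  latticeSightline {u} {v} {m} p short clear =
    sightline-of short (prefix ▷ last) (avoids-▷ {X = X} prefix last clear)
    where
    open LatticePath p
    adj : ∀ {i x′ y′} → i ≤ m → KingMove (xs i) (ys i) x′ y′ → x′ ≤ T → y′ ≤ R →
          Adj (Grid T R) (point (xs i) (ys i)) (point x′ y′)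
    adj i≤m (dx , dy , moved) x′≤T y′≤R = point-adj (xs≤T i≤m) x′≤T (ys≤R i≤m) y′≤R dx dy moved
    prefix : Route (Grid T R) u (point (xs m) (ys m)) m
    prefix = record
      { at   = λ i → point (xs i) (ys i)
      ; at-0 = trans (cong₂ point xs-0 ys-0) (point-coords u)
      ; at-n = refl
      ; step = λ i<m → adj (<⇒≤ i<m) (moves i<m) (xs≤T i<m) (ys≤R i<m)
      }
    last : Adj (Grid T R) (point (xs m) (ys m)) v
    last = subst (Adj (Grid T R) _) (point-coords v) (adj ≤-refl lands (toℕ≤pred _) (toℕ≤pred _))

  RowParity : V (Grid T R) → Set
  RowParity u = ∀ {w} → X w → parity (y-coord w) ≡ parity (y-coord u)

  Shielded : V (Grid T R) → V (Grid T R) → Set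
  Shielded u v = ∀ {w} → X w → Between (y-coord u) (y-coord w) (y-coord v) →
                 parity (x-coord w) ≢ parity (x-coord u)

  -- The row in which a shallow sightline waits before its last step.
  record Approach (y₁ y₂ m : ℕ) : Set where
    field
      ŷ         : ℕ
      ŷ≤R       : ŷ ≤ R
      ŷ-odd     : parity ŷ ≢ parity y₁
      ŷ-between : ∀ {y} → Between y₁ y ŷ → Between y₁ y y₂
      reached   : Near (toward y₁ ŷ m) y₂

  neighbour : 1 ≤ R → ∀ y → y ≤ R → Σ ℕ λ ŷ → ŷ ≤ R × Near y ŷ × y ≢ ŷ
  neighbour 1≤R zero    _   = 1 , 1≤R , near-suc 0 , λ ()
  neighbour _   (suc y) y≤R = y , ≤-trans (n≤1+n y) y≤R , near-sym {y} (near-suc y) , 1+n≢n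

  levelApproach : ∀ {y m} → 1 ≤ R → y ≤ R → Approach y y m
  levelApproach {y} {m} 1≤R y≤R with neighbour 1≤R y y≤R
  ... | ŷ , ŷ≤R , y~ŷ , y≢ŷ = record
    { ŷ         = ŷ
    ; ŷ≤R       = ŷ≤R
    ; ŷ-odd     = λ ŷ≡y → y≢ŷ (sym (near∧parity≡⇒≡ (near-sym {y} y~ŷ) ŷ≡y))
    ; ŷ-between = λ btw → ⊥-elim (¬between-near y~ŷ btw)
    ; reached   = reached m
    }
    where
    reached : ∀ m → Near (toward y ŷ m) y
    reached zero    rewrite toward-0 y ŷ = near-refl y
    reached (suc m) rewrite toward-end y ŷ {suc m} (≤-trans y~ŷ (s≤s z≤n)) = near-sym {y} y~ŷ

  risingApproach : ∀ {y₁ y₂ m d} → y₁ ≤ R → y₂ ≤ R → parity y₂ ≡ parity y₁ →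
                   ∣ y₁ - y₂ ∣ ≡ suc d → d ≤ m → Approach y₁ y₂ m
  risingApproach {y₁} {y₂} {m} {d} y₁≤R y₂≤R y₂≡y₁ dy≡ d≤m = record
    { ŷ         = ŷ
    ; ŷ≤R       = ≤-trans (toward-≤ y₁ y₂ d) (⊔-lub y₁≤R y₂≤R)
    ; ŷ-odd     = odd-offset y₁ ŷ d-odd (toward-parity y₁ y₂ d≤dy)
    ; ŷ-between = λ btw → between-trans btw ŷ-between
    ; reached   = subst₂ Near (sym (toward-end y₁ ŷ (subst (_≤ m) (sym (toward-dist y₁ y₂ d≤dy)) d≤m)))
                             (toward-end y₁ y₂ (≤-reflexive dy≡)) (toward-near y₁ y₂ d)
    }
    where
    ŷ : ℕ
    ŷ = toward y₁ y₂ d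
    d≤dy : d ≤ ∣ y₁ - y₂ ∣
    d≤dy = subst (d ≤_) (sym dy≡) (n≤1+n d)
    p₂≡p₁+p[1+d] : parity y₂ ≡ parity y₁ ⊕ parity (suc d)
    p₂≡p₁+p[1+d] = subst (λ n → parity y₂ ≡ parity y₁ ⊕ parity n) dy≡ (parity-∣-∣ y₁ y₂)
    d-odd : parity d ≡ 1ℙ
    d-odd = ⊕-cancelˡ-≡ 1ℙ (parity d) 1ℙ (trans (sym (parity-suc d)) (even-offset y₁ y₂ p₂≡p₁+p[1+d] y₂≡y₁))
    ŷ-between : Between y₁ ŷ y₂
    ŷ-between = toward-between y₁ y₂ (odd⇒positive d-odd) (subst (d <_) (sym dy≡) (n<1+n d))

  approach : ∀ {y₁ y₂ m} → 1 ≤ R → y₁ ≤ R → y₂ ≤ R → parity y₂ ≡ parity y₁ →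
             ∣ y₁ - y₂ ∣ ≤ suc m → Approach y₁ y₂ m
  approach {y₁} {y₂} {m} 1≤R y₁≤R y₂≤R y₂≡y₁ dy≤ with ∣ y₁ - y₂ ∣ in dy≡
  ... | zero  = subst (λ y → Approach y y₂ m) (sym (∣m-n∣≡0⇒m≡n dy≡)) (levelApproach 1≤R y₂≤R)
  ... | suc d = risingApproach y₁≤R y₂≤R y₂≡y₁ dy≡ (s≤s⁻¹ dy≤)

  module _ {u v : V (Grid T R)} (rowParity : RowParity u) (shielded : Shielded u v) where

    private
      x₁ y₁ x₂ y₂ : ℕ
      x₁ = x-coord u
      y₁ = y-coord u
      x₂ = x-coord v
      y₂ = y-coord v
      x₁≤T : x₁ ≤ T
      x₁≤T = toℕ≤pred (proj₁ u)
      x₂≤T : x₂ ≤ T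
      x₂≤T = toℕ≤pred (proj₁ v)
      y₁≤R : y₁ ≤ R
      y₁≤R = toℕ≤pred (proj₂ u)
      y₂≤R : y₂ ≤ R
      y₂≤R = toℕ≤pred (proj₂ v)

    blocked : ∀ {x y} → x ≤ T → y ≤ R → X (point x y) →
              parity y ≡ parity y₁ × (Between y₁ y y₂ → parity x ≢ parity x₁)
    blocked x≤T y≤R Xp =
      subst (λ y → parity y ≡ parity y₁) (toℕ-clamp y≤R) (rowParity Xp) ,
      λ btw → subst (λ x → parity x ≢ parity x₁) (toℕ-clamp x≤T)
                (shielded Xp (subst (λ y → Between y₁ y y₂) (sym (toℕ-clamp y≤R)) btw))

    -- The column advances at every step, so while the row is strictly between y₁ and ŷ,
    -- even row offsets come with even column offsets.
    shallow : ∀ {m} → Approach y₁ y₂ m → ∣ x₁ - x₂ ∣ ≡ suc m → Sightline u v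
    shallow {m} a dx≡ = latticeSightline path (subst (_≤ chebyshev u v) dx≡ (m≤m⊔n _ _)) clear
      where
      open Approach a
      i<dx : ∀ {i} → i < suc m → i < ∣ x₁ - x₂ ∣
      i<dx = subst (_ <_) (sym dx≡)
      path : LatticePath u v m
      path = record
        { xs    = toward x₁ x₂
        ; ys    = toward y₁ ŷ
        ; xs-0  = toward-0 x₁ x₂
        ; ys-0  = toward-0 y₁ ŷ
        ; xs≤T  = λ {i} _ → ≤-trans (toward-≤ x₁ x₂ i) (⊔-lub x₁≤T x₂≤T)
        ; ys≤R  = λ {i} _ → ≤-trans (toward-≤ y₁ ŷ i) (⊔-lub y₁≤R ŷ≤R)
        ; moves = λ {i} i<m → toward-near x₁ x₂ i , toward-near y₁ ŷ i ,
                              inj₁ (toward-moves x₁ x₂ (i<dx (m<n⇒m<1+n i<m)))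
        ; lands = subst (λ x → KingMove (toward x₁ x₂ m) (toward y₁ ŷ m) x y₂) x-end
                    (toward-near x₁ x₂ m , reached , inj₁ (toward-moves x₁ x₂ (i<dx ≤-refl)))
        }
        where
        x-end : toward x₁ x₂ (suc m) ≡ x₂
        x-end = toward-end x₁ x₂ (≤-reflexive dx≡)
      clear : ∀ {i} → 0 < i → i ≤ m → ¬ X (point (toward x₁ x₂ i) (toward y₁ ŷ i))
      clear {i} 0<i i≤m Xp with blocked (LatticePath.xs≤T path i≤m) (LatticePath.ys≤R path i≤m) Xp
      ... | sameRow , crossed with i <? ∣ y₁ - ŷ ∣
      ...   | no  i≮d =
        ŷ-odd (subst (λ y → parity y ≡ parity y₁) (toward-end y₁ ŷ (≮⇒≥ i≮d)) sameRow)
      ...   | yes i<d = crossed (ŷ-between (toward-between y₁ ŷ 0<i i<d))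
                              (toward-even-parity x₁ x₂ (<⇒≤ (i<dx (s≤s i≤m))) i-even)
        where
        i-even : parity i ≡ 0ℙ
        i-even = even-offset y₁ (toward y₁ ŷ i) (toward-parity y₁ ŷ (<⇒≤ i<d)) sameRow

    -- The row advances at every step and the column stops at the even offset E until the
    -- last step, so at even steps the column has the parity of x₁.
    steep : ∀ {m} → ∣ y₁ - y₂ ∣ ≡ suc m → ∣ x₁ - x₂ ∣ ≤ m → Sightline u v
    steep {m} dy≡ dx≤m with evenFloor ∣ x₁ - x₂ ∣
    ... | E , E-even , E≤dx , dx≤1+E =
      latticeSightline path (subst (_≤ chebyshev u v) dy≡ (m≤n⊔m _ _)) clear
      where
      i<dy : ∀ {i} → i < suc m → i < ∣ y₁ - y₂ ∣
      i<dy = subst (_ <_) (sym dy≡)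
      x-lands : Near (toward x₁ x₂ (m ⊓ E)) x₂
      x-lands = subst₂ Near (cong (toward x₁ x₂) (sym (m≥n⇒m⊓n≡n (≤-trans E≤dx dx≤m))))
                            (toward-end x₁ x₂ dx≤1+E) (toward-near x₁ x₂ E)
      path : LatticePath u v m
      path = record
        { xs    = λ i → toward x₁ x₂ (i ⊓ E)
        ; ys    = toward y₁ y₂
        ; xs-0  = toward-0 x₁ x₂
        ; ys-0  = toward-0 y₁ y₂
        ; xs≤T  = λ {i} _ → ≤-trans (toward-≤ x₁ x₂ (i ⊓ E)) (⊔-lub x₁≤T x₂≤T)
        ; ys≤R  = λ {i} _ → ≤-trans (toward-≤ y₁ y₂ i) (⊔-lub y₁≤R y₂≤R)
        ; moves = λ {i} i<m → toward-near-⊓ x₁ x₂ i E , toward-near y₁ y₂ i ,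
                              inj₂ (toward-moves y₁ y₂ (i<dy (m<n⇒m<1+n i<m)))
        ; lands = subst (λ y → KingMove (toward x₁ x₂ (m ⊓ E)) (toward y₁ y₂ m) x₂ y) y-end
                    (x-lands , toward-near y₁ y₂ m , inj₂ (toward-moves y₁ y₂ (i<dy ≤-refl)))
        }
        where
        y-end : toward y₁ y₂ (suc m) ≡ y₂
        y-end = toward-end y₁ y₂ (≤-reflexive dy≡)
      clear : ∀ {i} → 0 < i → i ≤ m → ¬ X (point (toward x₁ x₂ (i ⊓ E)) (toward y₁ y₂ i))
      clear {i} 0<i i≤m Xp with blocked (LatticePath.xs≤T path i≤m) (LatticePath.ys≤R path i≤m) Xp
      ... | sameRow , crossed = crossed (toward-between y₁ y₂ 0<i (i<dy (s≤s i≤m)))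
              (toward-even-parity x₁ x₂ (≤-trans (m⊓n≤n i E) E≤dx) (parity-⊓ {i} {E} i-even E-even))
        where
        i-even : parity i ≡ 0ℙ
        i-even = even-offset y₁ (toward y₁ y₂ i) (toward-parity y₁ y₂ (<⇒≤ (i<dy (s≤s i≤m)))) sameRow

    sightline : 1 ≤ R → u ≢ v → parity y₂ ≡ parity y₁ → Sightline u v
    sightline 1≤R u≢v y₂≡y₁ with ∣ y₁ - y₂ ∣ ≤? ∣ x₁ - x₂ ∣
    ... | yes dy≤dx with ∣ x₁ - x₂ ∣ in dx≡
    ...   | zero  =
      ⊥-elim (u≢v (coords-injective (∣m-n∣≡0⇒m≡n dx≡) (∣m-n∣≡0⇒m≡n (n≤0⇒n≡0 dy≤dx))))
    ...   | suc m = shallow (approach 1≤R y₁≤R y₂≤R y₂≡y₁ dy≤dx) dx≡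
    sightline 1≤R u≢v y₂≡y₁ | no dy≰dx with ∣ y₁ - y₂ ∣ in dy≡
    ...   | suc m = steep dy≡ (s≤s⁻¹ (≰⇒> dy≰dx))
    ...   | zero  = ⊥-elim (dy≰dx z≤n)

  visible : ∀ {u v} → 1 ≤ R → u ≢ v → RowParity u → parity (y-coord v) ≡ parity (y-coord u) →
            Shielded u v ⊎ Shielded v u → Visible (Grid T R) X u v
  visible 1≤R u≢v rowParity v≡u (inj₁ shielded) =
    sightline⇒visible (sightline rowParity shielded 1≤R u≢v v≡u)
  visible 1≤R u≢v rowParity v≡u (inj₂ shielded) =
    sightline⇒visible (sightline-reverse (sightline (λ Xw → trans (rowParity Xw) (sym v≡u)) shielded
                                                    1≤R (u≢v ∘ sym) (sym v≡u)))

-- Sets of four rows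

inner : Fin 4 → Parity
inner 0F = 0ℙ
inner 1F = 1ℙ
inner 2F = 1ℙ
inner 3F = 0ℙ

between-inner : ∀ (p r q : Fin 4) → Between (toℕ p) (toℕ r) (toℕ q) → inner r ≡ 1ℙ
between-inner _ 0F _ (inj₁ (() , _))
between-inner _ 0F _ (inj₂ (() , _))
between-inner _ 1F _ _ = refl
between-inner _ 2F _ _ = refl
between-inner _ 3F q (inj₁ (_ , 3<q)) = ⊥-elim (<⇒≱ 3<q (s≤s⁻¹ (toℕ<n q)))
between-inner p 3F _ (inj₂ (_ , 3<p)) = ⊥-elim (<⇒≱ 3<p (s≤s⁻¹ (toℕ<n p)))

inner-range : ∀ (p : Fin 4) → inner p ≡ 1ℙ → 1 ≤ toℕ p × toℕ p ≤ 2
inner-range 1F _ = s≤s z≤n , s≤s z≤n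
inner-range 2F _ = s≤s z≤n , s≤s (s≤s z≤n)
inner-range 0F ()
inner-range 3F ()

inners-adjacent : ∀ {p q} (r : Fin 4) → inner p ≡ 1ℙ → inner q ≡ 1ℙ →
                  ¬ Between (toℕ p) (toℕ r) (toℕ q)
inners-adjacent {p} {q} r ip iq (inj₁ (p<r , r<q)) =
  <⇒≱ (≤-trans (s≤s (≤-trans (s≤s (proj₁ (inner-range p ip))) p<r)) r<q) (proj₂ (inner-range q iq))
inners-adjacent {p} {q} r ip iq (inj₂ (q<r , r<p)) =
  <⇒≱ (≤-trans (s≤s (≤-trans (s≤s (proj₁ (inner-range q iq))) q<r)) r<p) (proj₂ (inner-range p ip))

record FourRows {T R : ℕ} (X : V (Grid T R) → Set) : Set where
  field
    row        : Fin 4 → ℕ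
    row-<      : ∀ {p q} → p Fin.< q → row p < row q
    row-parity : ∀ p q → parity (row p) ≡ parity (row q)
    outer      : Parity
    member     : ∀ {w} → X w → Σ (Fin 4) λ p → y-coord w ≡ row p × parity (x-coord w) ≡ outer ⊕ inner p

  row-reflects-< : ∀ {p q} → row p < row q → toℕ p < toℕ q
  row-reflects-< {p} {q} rp<rq with <-cmp (toℕ p) (toℕ q)
  ... | tri< p<q _ _ = p<q
  ... | tri≈ _ p≡q _ = ⊥-elim (<-irrefl (cong row (toℕ-injective p≡q)) rp<rq)
  ... | tri> _ _ q<p = ⊥-elim (<-asym rp<rq (row-< q<p))

  row-injective : ∀ {p q} → row p ≡ row q → p ≡ q
  row-injective {p} {q} rp≡rq with <-cmp (toℕ p) (toℕ q)
  ... | tri< p<q _ _ = ⊥-elim (<-irrefl rp≡rq (row-< p<q))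
  ... | tri≈ _ p≡q _ = toℕ-injective p≡q
  ... | tri> _ _ q<p = ⊥-elim (<-irrefl (sym rp≡rq) (row-< q<p))

  row-reflects-between : ∀ {p r q} → Between (row p) (row r) (row q) → Between (toℕ p) (toℕ r) (toℕ q)
  row-reflects-between (inj₁ (a , b)) = inj₁ (row-reflects-< a , row-reflects-< b)
  row-reflects-between (inj₂ (a , b)) = inj₂ (row-reflects-< a , row-reflects-< b)

module _ {T R : ℕ} {X : V (Grid T R) → Set} (rows : FourRows X) where

  open FourRows rows
  open Sightlines X using (Shielded; visible)

  member-between : ∀ {w p q} → X w → Between (row p) (y-coord w) (row q) →
                   Σ (Fin 4) λ r → Between (toℕ p) (toℕ r) (toℕ q) × parity (x-coord w) ≡ outer ⊕ inner r
  member-between {q = q} Xw btw with member Xw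
  ... | r , yw , pxw = r , row-reflects-between (subst (λ y → Between _ y (row q)) yw btw) , pxw

  fourRows-shielded : ∀ {u v p q} → y-coord u ≡ row p → parity (x-coord u) ≡ outer ⊕ inner p →
                      y-coord v ≡ row q → inner p ≡ 0ℙ ⊎ (inner p ≡ 1ℙ × inner q ≡ 1ℙ) → Shielded u v
  fourRows-shielded {u} {v} {p} {q} yu pxu yv position {w} Xw btw pxw≡pxu
    with member-between {p = p} {q} Xw (subst₂ (λ a b → Between a _ b) yu yv btw) | position
  ... | r , p<r<q , _   | inj₂ (ip , iq) = inners-adjacent r ip iq p<r<q
  ... | r , p<r<q , pxw | inj₁ ip = 1ℙ≢0ℙ (⊕-cancelˡ-≡ outer 1ℙ 0ℙ (begin
    outer ⊕ 1ℙ          ≡⟨ cong (outer ⊕_) (sym (between-inner p r q p<r<q)) ⟩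
    outer ⊕ inner r     ≡⟨ sym pxw ⟩
    parity (x-coord w)  ≡⟨ pxw≡pxu ⟩
    parity (x-coord u)  ≡⟨ pxu ⟩
    outer ⊕ inner p     ≡⟨ cong (outer ⊕_) ip ⟩
    outer ⊕ 0ℙ          ∎))
    where
    open ≡-Reasoning
    1ℙ≢0ℙ : 1ℙ ≢ 0ℙ
    1ℙ≢0ℙ ()

  fourRows⇒IMV : 1 ≤ R → IsIMV (Grid T R) X
  fourRows⇒IMV 1≤R = independent , mutuallyVisible
    where
    same-row-parity : ∀ {w w′} → X w → X w′ → parity (y-coord w) ≡ parity (y-coord w′)
    same-row-parity Xw Xw′ with member Xw | member Xw′
    ... | p , yw , _ | q , yw′ , _ = trans (cong parity yw) (trans (row-parity p q) (cong parity (sym yw′)))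

    independent : Independent (Grid T R) X
    independent (a , b) (a′ , b′) Xu Xv (u≢v , a~a′ , b~b′) with member Xu | member Xv
    ... | p , yu , pxu | q , yv , pxv = u≢v (coords-injective x≡x′ y≡y′)
      where
      y≡y′ : toℕ b ≡ toℕ b′
      y≡y′ = near∧parity≡⇒≡ (adjOrEq⇒near b~b′) (same-row-parity Xu Xv)
      x≡x′ : toℕ a ≡ toℕ a′
      x≡x′ = near∧parity≡⇒≡ (adjOrEq⇒near a~a′)
               (trans pxu (trans (cong (λ s → outer ⊕ inner s) p≡q) (sym pxv)))
        where
        p≡q : p ≡ q
        p≡q = row-injective (trans (sym yu) (trans y≡y′ yv))

    mutuallyVisible : ∀ u v → X u → X v → u ≢ v → Visible (Grid T R) X u v
    mutuallyVisible u v Xu Xv u≢v with member Xu | member Xv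
    ... | p , yu , pxu | q , yv , pxv =
      visible 1≤R u≢v (λ Xw → same-row-parity Xw Xu) (same-row-parity Xv Xu)
              (shielding (inner p) refl (inner q) refl)
      where
      -- Only inner rows lie strictly between two rows of the class, and none between the
      -- two inner ones.
      shielding : ∀ s → inner p ≡ s → ∀ t → inner q ≡ t → Shielded u v ⊎ Shielded v u
      shielding 0ℙ ip _  _  = inj₁ (fourRows-shielded {u} {v} yu pxu yv (inj₁ ip))
      shielding 1ℙ ip 1ℙ iq = inj₁ (fourRows-shielded {u} {v} yu pxu yv (inj₂ (ip , iq)))
      shielding 1ℙ _  0ℙ iq = inj₂ (fourRows-shielded {v} {u} yv pxv yu (inj₁ iq))

-- The colouring

lowerRow upperRow : Fin 2 → Fin 4
lowerRow 0F = 0F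
lowerRow 1F = 1F
upperRow 0F = 2F
upperRow 1F = 3F

inner-lowerRow : ∀ e → inner (lowerRow e) ≡ parity (toℕ e)
inner-lowerRow 0F = refl
inner-lowerRow 1F = refl

inner-upperRow : ∀ e → inner (upperRow e) ≡ 1ℙ ⊕ parity (toℕ e)
inner-upperRow 0F = refl
inner-upperRow 1F = refl

halfRows : ℕ → ℕ → Fin 4 → ℕ
halfRows j₀ j₁ 0F = 0 + j₀ * 2
halfRows j₀ j₁ 1F = 1 + j₀ * 2
halfRows j₀ j₁ 2F = 0 + j₁ * 2
halfRows j₀ j₁ 3F = 1 + j₁ * 2

halfRows-lowerRow : ∀ j₀ j₁ e → halfRows j₀ j₁ (lowerRow e) ≡ toℕ e + j₀ * 2
halfRows-lowerRow j₀ j₁ 0F = refl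
halfRows-lowerRow j₀ j₁ 1F = refl

halfRows-upperRow : ∀ j₀ j₁ e → halfRows j₀ j₁ (upperRow e) ≡ toℕ e + j₁ * 2
halfRows-upperRow j₀ j₁ 0F = refl
halfRows-upperRow j₀ j₁ 1F = refl

halfRows-< : ∀ {j₀ j₁} → j₀ < j₁ → ∀ {p q} → p Fin.< q → halfRows j₀ j₁ p < halfRows j₀ j₁ q
halfRows-< _     {0F} {1F} _ = n<1+n _
halfRows-< j₀<j₁ {0F} {2F} _ = *-monoˡ-< 2 j₀<j₁
halfRows-< j₀<j₁ {0F} {3F} _ = m<n⇒m<1+n (*-monoˡ-< 2 j₀<j₁)
halfRows-< j₀<j₁ {1F} {2F} _ = *-monoˡ-≤ 2 j₀<j₁
halfRows-< j₀<j₁ {1F} {3F} _ = s<s (*-monoˡ-< 2 j₀<j₁)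
halfRows-< _     {2F} {3F} _ = n<1+n _
halfRows-< _     {_}  {0F} ()
halfRows-< _     {1F} {1F} (s≤s ())
halfRows-< _     {2F} {1F} (s≤s ())
halfRows-< _     {3F} {1F} (s≤s ())
halfRows-< _     {2F} {2F} (s≤s (s≤s ()))
halfRows-< _     {3F} {2F} (s≤s (s≤s ()))
halfRows-< _     {3F} {3F} (s≤s (s≤s (s≤s ())))

-- Write y = 4 · block + 2 · e + s with e, s < 2.  The vertex (x , y) gets class `block` if
-- x ≡ e (mod 2) and the cyclically preceding class otherwise, so class c of slice s lies on the
-- rows of the blocks c and next c, with opposite column parities in the two blocks.
module Colouring (k : ℕ) (2≤k : 2 ≤ k) {T R : ℕ} (R<4k : R < 4 * k) where

  halfRowOf blockOf : V (Grid T R) → ℕ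
  halfRowOf v = y-coord v / 2
  blockOf v = halfRowOf v / 2

  sliceOf : V (Grid T R) → Fin 2
  sliceOf v = y-coord v mod 2

  y≡slice+halfRow*2 : ∀ v → y-coord v ≡ toℕ (sliceOf v) + halfRowOf v * 2
  y≡slice+halfRow*2 v = DivMod.property (y-coord v divMod 2)

  halfRow≡e+block*2 : ∀ v → halfRowOf v ≡ toℕ (halfRowOf v mod 2) + blockOf v * 2
  halfRow≡e+block*2 v = DivMod.property (halfRowOf v divMod 2)

  parity-halfRow : ∀ v → parity (halfRowOf v) ≡ parity (toℕ (halfRowOf v mod 2))
  parity-halfRow v = trans (cong parity (halfRow≡e+block*2 v)) (parity-+-*2 (toℕ (halfRowOf v mod 2)) (blockOf v))

  blockOf<k : ∀ v → blockOf v < k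
  blockOf<k v = m<n*o⇒m/o<n (subst (halfRowOf v <_) (*-comm 2 k) (m<n*o⇒m/o<n y<2k*2))
    where
    y<2k*2 : y-coord v < 2 * k * 2
    y<2k*2 = subst (y-coord v <_) (trans (*-assoc 2 2 k) (*-comm 2 (2 * k)))
                   (≤-<-trans (toℕ≤pred (proj₂ v)) R<4k)

  InBlock : ℕ → Parity → V (Grid T R) → Set
  InBlock j σ v = blockOf v ≡ j × parity (x-coord v) ≡ σ ⊕ parity (halfRowOf v)

  twoBlocks⇒fourRows : ∀ {X : V (Grid T R) → Set} s {j₀ j₁} σ → j₀ < j₁ →
    (∀ {v} → X v → sliceOf v ≡ s × (InBlock j₀ σ v ⊎ InBlock j₁ (1ℙ ⊕ σ) v)) → FourRows X
  twoBlocks⇒fourRows {X} s {j₀} {j₁} σ j₀<j₁ placed = record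
    { row        = row
    ; row-<      = λ p<q → +-monoʳ-< (toℕ s) (*-monoˡ-< 2 (halfRows-< j₀<j₁ p<q))
    ; row-parity = λ p q → trans (parity-+-*2 (toℕ s) (halfRows j₀ j₁ p))
                                 (sym (parity-+-*2 (toℕ s) (halfRows j₀ j₁ q)))
    ; outer      = σ
    ; member     = member
    }
    where
    row : Fin 4 → ℕ
    row p = toℕ s + halfRows j₀ j₁ p * 2
    y-at : ∀ {v j} p → sliceOf v ≡ s → blockOf v ≡ j →
           halfRows j₀ j₁ p ≡ toℕ (halfRowOf v mod 2) + j * 2 → y-coord v ≡ row p
    y-at {v} {j} p sv≡s bv≡j hp = begin
      y-coord v                             ≡⟨ y≡slice+halfRow*2 v ⟩
      toℕ (sliceOf v) + halfRowOf v * 2     ≡⟨ cong₂ (λ a h → toℕ a + h * 2) sv≡s (halfRow≡e+block*2 v) ⟩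
      toℕ s + (toℕ e + blockOf v * 2) * 2   ≡⟨ cong (λ b → toℕ s + (toℕ e + b * 2) * 2) bv≡j ⟩
      toℕ s + (toℕ e + j * 2) * 2           ≡⟨ cong (λ h → toℕ s + h * 2) (sym hp) ⟩
      row p                                 ∎
      where
      e : Fin 2
      e = halfRowOf v mod 2
      open ≡-Reasoning
    member : ∀ {v} → X v → Σ (Fin 4) λ p → y-coord v ≡ row p × parity (x-coord v) ≡ σ ⊕ inner p
    member {v} Xv with placed {v} Xv
    ... | sv≡s , inj₁ (bv≡j₀ , px) =
      lowerRow e , y-at {v} (lowerRow e) sv≡s bv≡j₀ (halfRows-lowerRow j₀ j₁ e) ,
      trans px (cong (σ ⊕_) (trans (parity-halfRow v) (sym (inner-lowerRow e))))
      where
      e : Fin 2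
      e = halfRowOf v mod 2
    ... | sv≡s , inj₂ (bv≡j₁ , px) =
      upperRow e , y-at {v} (upperRow e) sv≡s bv≡j₁ (halfRows-upperRow j₀ j₁ e) ,
      trans px (begin
        (1ℙ ⊕ σ) ⊕ parity (halfRowOf v)   ≡⟨ cong (λ q → (1ℙ ⊕ σ) ⊕ q) (parity-halfRow v) ⟩
        (1ℙ ⊕ σ) ⊕ parity (toℕ e)         ≡⟨ cong (_⊕ parity (toℕ e)) (⊕-comm 1ℙ σ) ⟩
        (σ ⊕ 1ℙ) ⊕ parity (toℕ e)         ≡⟨ ⊕-assoc σ 1ℙ (parity (toℕ e)) ⟩
        σ ⊕ (1ℙ ⊕ parity (toℕ e))         ≡⟨ cong (σ ⊕_) (sym (inner-upperRow e)) ⟩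
        σ ⊕ inner (upperRow e)            ∎)
      where
      e : Fin 2
      e = halfRowOf v mod 2
      open ≡-Reasoning

  predMod : ℕ → ℕ
  predMod zero    = pred k
  predMod (suc j) = j

  next : ℕ → ℕ
  next c = if does (suc c <? k) then suc c else 0

  1+pred[k]≡k : suc (pred k) ≡ k
  1+pred[k]≡k = suc-pred k {{>-nonZero (≤-trans (s≤s z≤n) 2≤k)}}

  predMod≡⇒next : ∀ {j c} → j < k → predMod j ≡ c → j ≡ next c
  predMod≡⇒next {zero}  {c} _   refl rewrite dec-false (suc (pred k) <? k) (<-irrefl 1+pred[k]≡k) = refl
  predMod≡⇒next {suc j} {c} j<k refl rewrite dec-true (suc j <? k) j<k = refl

  c≢next : ∀ c → c ≢ next c
  c≢next c with suc c <? k
  ... | yes 1+c<k rewrite dec-true (suc c <? k) 1+c<k = 1+n≢n ∘ sym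
  ... | no  1+c≮k rewrite dec-false (suc c <? k) 1+c≮k = λ { refl → 1+c≮k 2≤k }

  classOf : V (Grid T R) → ℕ
  classOf v = if does (parity (x-coord v) ≟ℙ parity (halfRowOf v)) then blockOf v else predMod (blockOf v)

  classOf-cases : ∀ v → (classOf v ≡ blockOf v × InBlock (blockOf v) 0ℙ v)
                      ⊎ (classOf v ≡ predMod (blockOf v) × InBlock (blockOf v) 1ℙ v)
  classOf-cases v with parity (x-coord v) ≟ℙ parity (halfRowOf v)
  ... | yes px≡ph = inj₁ (refl , refl , px≡ph)
  ... | no  px≢ph = inj₂ (refl , refl , ≢⇒≡1ℙ⊕ px≢ph)

  classOf<k : ∀ v → classOf v < k
  classOf<k v with classOf-cases v
  ... | inj₁ (c≡b , _) = subst (_< k) (sym c≡b) (blockOf<k v)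
  ... | inj₂ (c≡b , _) = subst (_< k) (sym c≡b) (predMod< (blockOf<k v))
    where
    predMod< : ∀ {j} → j < k → predMod j < k
    predMod< {zero}  _   = subst (pred k <_) 1+pred[k]≡k (n<1+n (pred k))
    predMod< {suc j} j<k = <-trans (n<1+n j) j<k

  class⇒blocks : ∀ {v c} → classOf v ≡ c → InBlock c 0ℙ v ⊎ InBlock (next c) 1ℙ v
  class⇒blocks {v} cv≡c with classOf-cases v
  ... | inj₁ (cv≡b , _ , px) = inj₁ (trans (sym cv≡b) cv≡c , px)
  ... | inj₂ (cv≡p , _ , px) = inj₂ (predMod≡⇒next (blockOf<k v) (trans (sym cv≡p) cv≡c) , px)

  colour : V (Grid T R) → Fin (2 * k)
  colour v = Fin.combine (sliceOf v) (fromℕ< (classOf<k v))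

  colourClass-fourRows : ∀ i → FourRows (λ v → colour v ≡ i)
  colourClass-fourRows i = byOrder (<-cmp c (next c))
    where
    s : Fin 2
    s = proj₁ (Fin.remQuot k i)
    c : ℕ
    c = toℕ (proj₂ (Fin.remQuot k i))
    decoded : ∀ {v} → colour v ≡ i → (sliceOf v , fromℕ< (classOf<k v)) ≡ Fin.remQuot k i
    decoded {v} cv≡i =
      trans (sym (remQuot-combine (sliceOf v) (fromℕ< (classOf<k v)))) (cong (Fin.remQuot k) cv≡i)
    slice≡ : ∀ {v} → colour v ≡ i → sliceOf v ≡ s
    slice≡ {v} = cong proj₁ ∘ decoded {v}
    class≡ : ∀ {v} → colour v ≡ i → classOf v ≡ c
    class≡ {v} cv≡i = trans (sym (toℕ-fromℕ< (classOf<k v))) (cong (toℕ ∘ proj₂) (decoded {v} cv≡i))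
    byOrder : Tri (c < next c) (c ≡ next c) (next c < c) → FourRows (λ v → colour v ≡ i)
    byOrder (tri< c<next _ _) = twoBlocks⇒fourRows s 0ℙ c<next λ {v} cv≡i →
      slice≡ {v} cv≡i , class⇒blocks {v} (class≡ {v} cv≡i)
    byOrder (tri≈ _ c≡next _) = ⊥-elim (c≢next c c≡next)
    byOrder (tri> _ _ next<c) = twoBlocks⇒fourRows s 1ℙ next<c λ {v} cv≡i →
      slice≡ {v} cv≡i , swap (class⇒blocks {v} (class≡ {v} cv≡i))

  partition : 1 ≤ R → HasIMVPartition (Grid T R) (2 * k)
  partition 1≤R = colour , λ i → fourRows⇒IMV (colourClass-fourRows i) 1≤R

-- Lower bounds

-- code j is f j tagged with whether the value f j already occurs before j; two equal codes
-- yield three equal values.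
pigeonhole₃ : ∀ {m n} → m + m < n → (f : Fin n → Fin m) →
              ∃ λ i → ∃ λ j → ∃ λ l → i Fin.< j × j Fin.< l × f i ≡ f j × f j ≡ f l
pigeonhole₃ {m} {n} 2m<n f = collide (pigeonhole 2m<n code)
  where
  Repeated : Fin n → Set
  Repeated j = ∃ λ i → i Fin.< j × f i ≡ f j
  repeated? : ∀ j → Dec (Repeated j)
  repeated? j = any? (λ i → (i <?F j) ×-dec (f i ≟F f j))
  code : Fin n → Fin (m + m)
  code j with repeated? j
  ... | yes _ = m Fin.↑ʳ f j
  ... | no  _ = f j Fin.↑ˡ m
  ↑ʳ≢↑ˡ : ∀ a b → m Fin.↑ʳ a ≢ b Fin.↑ˡ m
  ↑ʳ≢↑ˡ a b eq = <⇒≱ (toℕ<n b) (≤-trans (m≤m+n m (toℕ a))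
                       (≤-reflexive (trans (sym (toℕ-↑ʳ m a)) (trans (cong toℕ eq) (toℕ-↑ˡ b m)))))
  collide : (∃ λ j → ∃ λ l → j Fin.< l × code j ≡ code l) →
            ∃ λ i → ∃ λ j → ∃ λ l → i Fin.< j × j Fin.< l × f i ≡ f j × f j ≡ f l
  collide (j , l , j<l , eq) with repeated? j | repeated? l
  ... | yes (i , i<j , fi≡fj) | yes _ = i , j , l , i<j , j<l , fi≡fj , ↑ʳ-injective m (f j) (f l) eq
  ... | no  _                 | no ¬l = ⊥-elim (¬l (j , j<l , ↑ˡ-injective m (f j) (f l) eq))
  ... | yes _                 | no _  = ⊥-elim (↑ʳ≢↑ˡ (f j) (f l) eq)
  ... | no  _                 | yes _ = ⊥-elim (↑ʳ≢↑ˡ (f l) (f j) (sym eq))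

clique-lower-bound : ∀ {G : Graph} {k m} (q : Fin k → V G) → (∀ {i j} → i Fin.< j → Adj G (q i) (q j)) →
                     m < k → ¬ HasIMVPartition G m
clique-lower-bound q q-adj m<k (c , imv) with pigeonhole m<k (c ∘ q)
... | i , j , i<j , ci≡cj = proj₁ (imv (c (q j))) (q i) (q j) ci≡cj refl (q-adj i<j)

module _ {T R : ℕ} where

  corner : Fin 4 → V (Grid (suc T) (suc R))
  corner i = point (toℕ i / 2) (toℕ i % 2)

  corner-adj : ∀ {i j} → i Fin.< j → Adj (Grid (suc T) (suc R)) (corner i) (corner j)
  corner-adj {i} {j} i<j =
    point-adj (≤-trans (half≤1 i) (s≤s z≤n)) (≤-trans (half≤1 j) (s≤s z≤n))
              (≤-trans (rem≤1 i) (s≤s z≤n)) (≤-trans (rem≤1 j) (s≤s z≤n))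
              (≤1-near (half≤1 i) (half≤1 j)) (≤1-near (rem≤1 i) (rem≤1 j)) moved
    where
    half≤1 : ∀ (i : Fin 4) → toℕ i / 2 ≤ 1
    half≤1 i = s≤s⁻¹ (m<n*o⇒m/o<n {n = 2} (toℕ<n i))
    rem≤1 : ∀ (i : Fin 4) → toℕ i % 2 ≤ 1
    rem≤1 i = s≤s⁻¹ (m%n<n (toℕ i) 2)
    ≤1-near : ∀ {a b} → a ≤ 1 → b ≤ 1 → Near a b
    ≤1-near {a} {b} a≤1 b≤1 = ≤-trans (∣m-n∣≤m⊔n a b) (⊔-lub a≤1 b≤1)
    moved : toℕ i / 2 ≢ toℕ j / 2 ⊎ toℕ i % 2 ≢ toℕ j % 2
    moved with toℕ i / 2 ≟ toℕ j / 2
    ... | no  halves≢ = inj₁ halves≢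
    ... | yes halves≡ = inj₂ λ rems≡ → <⇒≢ i<j (begin
      toℕ i                          ≡⟨ m≡m%n+[m/n]*n (toℕ i) 2 ⟩
      toℕ i % 2 + toℕ i / 2 * 2      ≡⟨ cong₂ (λ r h → r + h * 2) rems≡ halves≡ ⟩
      toℕ j % 2 + toℕ j / 2 * 2      ≡⟨ sym (m≡m%n+[m/n]*n (toℕ j) 2) ⟩
      toℕ j                          ∎)
      where open ≡-Reasoning

module _ {T R : ℕ} where

  short-walk-visits-diagonal : ∀ {Q : V (Grid T R) → Set} {u v} (w : Walk (Grid T R) u v) {d} →
    x-coord v ≡ x-coord u + d → y-coord v ≡ y-coord u + d → len w ≤ d → AllInternal Q w →
    ∀ {z e} → 0 < e → e < d → x-coord z ≡ x-coord u + e → y-coord z ≡ y-coord u + e → Q z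
  short-walk-visits-diagonal [ u ] {d} xv _ _ _ 0<e e<d _ _ =
    ⊥-elim (n≮0 (subst (_ <_) (sym (+-cancelˡ-≡ (x-coord u) 0 d (trans (+-identityʳ _) xv))) e<d))
  short-walk-visits-diagonal (_ ∷⟨ _ ⟩ _) {zero} _ _ _ _ _ ()
  short-walk-visits-diagonal _ {_} _ _ _ _ {e = zero} () _ _ _
  short-walk-visits-diagonal {Q} (_∷⟨_⟩_ u {u′} u~u′ w) {suc d} xv yv (s≤s len≤d) internal
                             {z} {suc zero} _ (s≤s 0<d) xz yz =
    head-internal w internal u′≢v
    where
    xu′ : x-coord u′ ≡ suc (x-coord u)
    xu′ = tight-first-step x-lipschitz u~u′ w xv len≤d
    yu′ : y-coord u′ ≡ suc (y-coord u)
    yu′ = tight-first-step y-lipschitz u~u′ w yv len≤d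
    u′≢v : u′ ≢ _
    u′≢v refl = <-irrefl (suc-injective (+-cancelˡ-≡ (x-coord u) 1 (suc d)
                  (trans (+-comm (x-coord u) 1) (trans (sym xu′) xv)))) 0<d
    z≡u′ : z ≡ u′
    z≡u′ = coords-injective (trans xz (trans (+-comm _ 1) (sym xu′)))
                            (trans yz (trans (+-comm _ 1) (sym yu′)))
    head-internal : ∀ {v} (w : Walk (Grid T R) u′ v) → AllButLast Q w → u′ ≢ v → Q z
    head-internal [ _ ]         _       u′≢u′ = ⊥-elim (u′≢u′ refl)
    head-internal (_ ∷⟨ _ ⟩ _) (q , _) _     = subst Q (sym z≡u′) q
  short-walk-visits-diagonal {Q} (_∷⟨_⟩_ u {u′} u~u′ w) {suc d} xv yv (s≤s len≤d) internal
                             {z} {suc (suc e)} _ (s≤s e<d) xz yz =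
    short-walk-visits-diagonal w (shift xu′ xv) (shift yu′ yv) len≤d (allButLast⇒allInternal w internal)
                    {z} {suc e} z<s e<d (shift xu′ xz) (shift yu′ yz)
    where
    xu′ : x-coord u′ ≡ suc (x-coord u)
    xu′ = tight-first-step x-lipschitz u~u′ w xv len≤d
    yu′ : y-coord u′ ≡ suc (y-coord u)
    yu′ = tight-first-step y-lipschitz u~u′ w yv len≤d
    shift : ∀ {c : V (Grid T R) → ℕ} {a n} → c u′ ≡ suc (c u) → a ≡ c u + suc n → a ≡ c u′ + n
    shift {c} {a} {n} cu′ a≡ = trans a≡ (trans (+-suc (c u) n) (cong (_+ n) (sym cu′)))

  diagonalRoute : ∀ {a b} → a ≤ b → b ≤ T → b ≤ R → Route (Grid T R) (point a a) (point b b) (b ∸ a)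
  diagonalRoute {a} {b} a≤b b≤T b≤R = record
    { at   = λ s → point (a + s) (a + s)
    ; at-0 = cong (λ c → point c c) (+-identityʳ a)
    ; at-n = cong (λ c → point c c) (m+[n∸m]≡n a≤b)
    ; step = λ {s} s<n → point-adj (≤T (<⇒≤ s<n)) (≤T s<n) (≤R (<⇒≤ s<n)) (≤R s<n)
                                     (step-near s) (step-near s) (inj₁ (step-moves s))
    }
    where
    step-near : ∀ s → Near (a + s) (a + suc s)
    step-near s = subst (Near (a + s)) (sym (+-suc a s)) (near-suc (a + s))
    step-moves : ∀ s → a + s ≢ a + suc s
    step-moves s e = 1+n≢n (sym (trans e (+-suc a s)))
    a+s≤b : ∀ {s} → s ≤ b ∸ a → a + s ≤ b
    a+s≤b s≤ = ≤-trans (+-monoʳ-≤ a s≤) (≤-reflexive (m+[n∸m]≡n a≤b))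
    ≤T : ∀ {s} → s ≤ b ∸ a → a + s ≤ T
    ≤T s≤ = ≤-trans (a+s≤b s≤) b≤T
    ≤R : ∀ {s} → s ≤ b ∸ a → a + s ≤ R
    ≤R s≤ = ≤-trans (a+s≤b s≤) b≤R

  diagonal-len≤ : ∀ {a b} → a ≤ b → b ≤ T → b ≤ R → (w : Walk (Grid T R) (point a a) (point b b)) →
                  Geodesic (Grid T R) w → len w ≤ b ∸ a
  diagonal-len≤ a≤b b≤T b≤R w geodesic with route-walk (diagonalRoute a≤b b≤T b≤R)
  ... | diagonal , len-diagonal , _ = subst (len w ≤_) len-diagonal (geodesic diagonal)

  diagonal-lower-bound : ∀ {m} N → N ≤ suc T → N ≤ suc R → m + m < N → ¬ HasIMVPartition (Grid T R) m
  diagonal-lower-bound {m} N N≤1+T N≤1+R 2m<N (c , imv) = collinear (pigeonhole₃ 2m<N (c ∘ diag))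
    where
    toℕ≤T : (j : Fin N) → toℕ j ≤ T
    toℕ≤T j = s≤s⁻¹ (≤-trans (toℕ<n j) N≤1+T)
    toℕ≤R : (j : Fin N) → toℕ j ≤ R
    toℕ≤R j = s≤s⁻¹ (≤-trans (toℕ<n j) N≤1+R)
    diag : Fin N → V (Grid T R)
    diag j = point (toℕ j) (toℕ j)
    x-diag : ∀ j → x-coord (diag j) ≡ toℕ j
    x-diag j = toℕ-clamp (toℕ≤T j)
    y-diag : ∀ j → y-coord (diag j) ≡ toℕ j
    y-diag j = toℕ-clamp (toℕ≤R j)
    diag-x : ∀ {i} j → toℕ i ≤ toℕ j → x-coord (diag j) ≡ x-coord (diag i) + (toℕ j ∸ toℕ i)
    diag-x {i} j i≤j = trans (x-diag j) (trans (sym (m+[n∸m]≡n i≤j)) (cong (_+ _) (sym (x-diag i))))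
    diag-y : ∀ {i} j → toℕ i ≤ toℕ j → y-coord (diag j) ≡ y-coord (diag i) + (toℕ j ∸ toℕ i)
    diag-y {i} j i≤j = trans (y-diag j) (trans (sym (m+[n∸m]≡n i≤j)) (cong (_+ _) (sym (y-diag i))))
    collinear : (∃ λ i → ∃ λ j → ∃ λ l → i Fin.< j × j Fin.< l ×
                   c (diag i) ≡ c (diag j) × c (diag j) ≡ c (diag l)) → ⊥
    collinear (i , j , l , i<j , j<l , ci≡cj , cj≡cl) =
      hidden (proj₂ (imv (c (diag l))) (diag i) (diag l) (trans ci≡cj cj≡cl) refl di≢dl)
      where
      i≤l : toℕ i ≤ toℕ l
      i≤l = <⇒≤ (<-trans i<j j<l)
      di≢dl : diag i ≢ diag l
      di≢dl e = <⇒≢ (<-trans i<j j<l) (trans (sym (x-diag i)) (trans (cong x-coord e) (x-diag l)))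
      hidden : ¬ Visible (Grid T R) (λ v → c v ≡ c (diag l)) (diag i) (diag l)
      hidden (w , geodesic , clear) =
        short-walk-visits-diagonal w (diag-x l i≤l) (diag-y l i≤l)
          (diagonal-len≤ i≤l (toℕ≤T l) (toℕ≤R l) w geodesic) clear {diag j}
          (m<n⇒0<n∸m i<j) (∸-monoˡ-< j<l (<⇒≤ i<j)) (diag-x j (<⇒≤ i<j)) (diag-y j (<⇒≤ i<j)) cj≡cl

initialSegments-isDiag : ∀ {t r} → r ≤ t → IsDiag (P t) (P r) r
initialSegments-isDiag r≤t =
  (_ , _ , initialSegment-convex r≤t , initialSegment-convex ≤-refl) ,
  λ n (_ , _ , _ , q-convex) → injective⇒≤ (proj₁ q-convex)

isChiMuI-4k : ∀ t k → 2 ≤ k → 4 * k ≤ t → IsChiMuI (P t ⊠ P (4 * k)) (2 * k)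
isChiMuI-4k (suc T) k@(suc _) 2≤k 4k≤t =
  Colouring.partition k 2≤k ≤-refl 1≤R ,
  λ m m<2k → diagonal-lower-bound (4 * k) 4k≤t ≤-refl (m+m<4k m<2k)
  where
  1≤R : 1 ≤ pred (4 * k)
  1≤R = s≤s⁻¹ (≤-trans 2≤k (m≤n*m k 4))
  m+m<4k : ∀ {m} → m < 2 * k → m + m < 4 * k
  m+m<4k {m} m<2k = subst (m + m <_) (sym (*-distribʳ-+ k 2 2)) (+-mono-< m<2k m<2k)

isChiMuI-short : ∀ t r → 3 ≤ r → r ≤ 7 → r ≤ t → IsChiMuI (P t ⊠ P r) 4
isChiMuI-short (suc (suc T)) (suc (suc R)) _ r≤7 _ =
  Colouring.partition 2 ≤-refl (m≤n⇒m≤1+n r≤7) (s≤s z≤n) ,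
  λ m m<4 → clique-lower-bound corner corner-adj m<4
isChiMuI-short _          (suc (suc zero))    (s≤s (s≤s ())) _ _
isChiMuI-short _          (suc zero)          (s≤s ()) _ _
isChiMuI-short zero       (suc (suc (suc _))) _ _ ()
isChiMuI-short (suc zero) (suc (suc (suc _))) _ _ (s≤s ())

theorem5p6 : ((t k : ℕ) → 2 ≤ k → 4 * k ≤ t →
    IsChiMuI (P t ⊠ P (4 * k)) (2 * k) × IsDiag (P t) (P (4 * k)) (2 * (2 * k)))
    × ((t r : ℕ) → 3 ≤ r → r ≤ 7 → r ≤ t → IsChiMuI (P t ⊠ P r) 4)
theorem5p6 =
  (λ t k 2≤k 4k≤t → isChiMuI-4k t k 2≤k 4k≤t ,
                    subst (IsDiag (P t) (P (4 * k))) (*-assoc 2 2 k) (initialSegments-isDiag 4k≤t)) ,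
  isChiMuI-short
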